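{- For any spanoids $\mathcal S_1,\mathcal S_2$ on finite sets $X_1,X_2$, $\mathrm{LP}^{cover}(\mathcal S_1\odot\mathcal S_2)=\mathrm{LP}^{cover}(\mathcal S_1)\cdot\mathrm{LP}^{cover}(\mathcal S_2)$.
   Context: A spanoid $\mathcal S$ on a finite set $X$ is a family of pairs $(S,i)$ with $S\subseteq X$, $i\in X$ (rules). For $T\subseteq X$, $i\in X$ write $T\models i$ if there is a sequence $T=T_0,\dots,T_r$ ($r\ge0$) with $i\in T_r$ such that for each $j\in[r]$, $T_j=T_{j-1}\cup\{i_j\}$ where some $S\subseteq T_{j-1}$ has $(S,i_j)\in\mathcal S$. $\mathrm{span}(T)=\{i:T\models i\}$. $B\subseteq X$ is closed if $\mathrm{span}(B)=B$, open if $X\setminus B$ is closed. The open sets of a spanoid form a union-closed family containing $\emptyset$ and $X$, and conversely every family of subsets of $X$ closed under arbitrary unions (including the empty union $\emptyset$) and containing $X$ is the family of open sets of a spanoid, unique up to having the same relation $\models$ (namely $A\models i$ iff $i$ lies in every closed set containing $A$). $\mathcal S_1\odot\mathcal S_2$ is the spanoid on $X_1\times X_2$ whose open sets are exactly all unions of sets $A\times B$ with $A$ open in $\mathcal S_1$ and $B$ open in $\mathcal S_2$. $\mathcal O^*$ is the family of inclusion-minimal nonempty open sets, and $\mathrm{LP}^{cover}(\mathcal S)=\min\{\sum_{i\in X}x_i: x\ge0,\ \sum_{i\in F}x_i\ge1\ \forall F\in\mathcal O^*\}$.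
   Formalization: The LP variables $x$ and the values of $\mathrm{LP}^{cover}$ are taken over the rationals. -}

module Defs where

open import Data.Nat using (ℕ; zero; suc)
open import Data.Fin using (Fin; zero; suc; remQuot)
open import Data.Fin.Subset using (Subset; _∈_; _⊆_; ∁; _∪_; ⁅_⁆; Nonempty)
open import Data.Bool using (Bool; true; false; if_then_else_)
open import Data.Vec using (lookup)
open import Data.List using (List)
open import Data.List.Membership.Propositional renaming (_∈_ to _∈ₗ_)
open import Data.Product using (_×_; _,_; ∃; Σ)
open import Data.Rational using (ℚ; 0ℚ; 1ℚ; _+_; _≤_)

-- A spanoid on X = Fin n: a (finite) family of rules (S , i).
Spanoid : ℕ → Set
Spanoid n = List (Subset n × Fin n)

data _⊢_⊨_ {n : ℕ} (𝒮 : Spanoid n) : Subset n → Fin n → Set where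
  base : ∀ {T i} → i ∈ T → 𝒮 ⊢ T ⊨ i
  step : ∀ {T i S j} → (S , j) ∈ₗ 𝒮 → S ⊆ T → 𝒮 ⊢ (T ∪ ⁅ j ⁆) ⊨ i → 𝒮 ⊢ T ⊨ i

-- B closed iff span(B) = B (span(B) ⊇ B always holds via `base`).
IsClosed : ∀ {n} → Spanoid n → Subset n → Set
IsClosed 𝒮 B = ∀ i → 𝒮 ⊢ B ⊨ i → i ∈ B

IsOpen : ∀ {n} → Spanoid n → Subset n → Set
IsOpen 𝒮 B = IsClosed 𝒮 (∁ B)

IsMinOpen : ∀ {n} → Spanoid n → Subset n → Set
IsMinOpen 𝒮 F = IsOpen 𝒮 F × Nonempty F ×
  (∀ G → IsOpen 𝒮 G → Nonempty G → G ⊆ F → F ⊆ G)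

-- X₁ × X₂ is represented as Fin (n₁ * n₂) via the stdlib bijection remQuot/combine.
inRect : ∀ {n₁ n₂} → Subset n₁ → Subset n₂ → Fin (n₁ Data.Nat.* n₂) → Set
inRect {n₁} {n₂} A B k with remQuot {n₁} n₂ k
... | (a , b) = (a ∈ A) × (b ∈ B)

-- U is a union of rectangles A × B with A open in 𝒮₁, B open in 𝒮₂
-- (namely U is the union of all such rectangles contained in U).
IsUnionOfOpenRects : ∀ {n₁ n₂} → Spanoid n₁ → Spanoid n₂ → Subset (n₁ Data.Nat.* n₂) → Set
IsUnionOfOpenRects {n₁} {n₂} 𝒮₁ 𝒮₂ U =
  ∀ k → k ∈ U → Σ (Subset n₁) λ A → Σ (Subset n₂) λ B →
    IsOpen 𝒮₁ A × IsOpen 𝒮₂ B × inRect A B k × (∀ k' → inRect A B k' → k' ∈ U)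

-- 𝒮 is (a representative of) 𝒮₁ ⊙ 𝒮₂: its open sets are exactly the unions of open rectangles.
IsProduct : ∀ {n₁ n₂} → Spanoid n₁ → Spanoid n₂ → Spanoid (n₁ Data.Nat.* n₂) → Set
IsProduct 𝒮₁ 𝒮₂ 𝒮 = ∀ U → (IsOpen 𝒮 U → IsUnionOfOpenRects 𝒮₁ 𝒮₂ U)
                        × (IsUnionOfOpenRects 𝒮₁ 𝒮₂ U → IsOpen 𝒮 U)

sumFin : ∀ n → (Fin n → ℚ) → ℚ
sumFin zero f = 0ℚ
sumFin (suc n) f = f zero + sumFin n (λ i → f (suc i))

sumOn : ∀ {n} → Subset n → (Fin n → ℚ) → ℚ
sumOn {n} F x = sumFin n (λ i → if lookup F i then x i else 0ℚ)

IsCoverFeasible : ∀ {n} → Spanoid n → (Fin n → ℚ) → Set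
IsCoverFeasible {n} 𝒮 x = (∀ i → 0ℚ ≤ x i) × (∀ F → IsMinOpen 𝒮 F → 1ℚ ≤ sumOn F x)

LPcoverIs : ∀ {n} → Spanoid n → ℚ → Set
LPcoverIs {n} 𝒮 v =
  (Σ (Fin n → ℚ) λ x → IsCoverFeasible 𝒮 x × sumFin n x Relation.Binary.PropositionalEquality.≡ v)
  × (∀ x → IsCoverFeasible 𝒮 x → v ≤ sumFin n x)
  where import Relation.Binary.PropositionalEquality

module Submission where

-- The proof rests on two
-- structural facts about minimal open sets of 𝒮 = 𝒮₁ ⊙ 𝒮₂:
--   (R1) if F₁, F₂ are minimal open then so is rect F₁ F₂;
--   (R2) every nonempty open set of 𝒮 contains such a rectangle
--        (classically: it contains an open rectangle, and every nonempty open
--        set contains a minimal one; the ¬¬ is removed since ≤ on ℚ is decidable).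
-- Upper bound: for optimal x, y the tensor x ⊗ y is feasible by (R2), since its
-- mass on rect F₁ F₂ is (Σ_{F₁} x)(Σ_{F₂} y) ≥ 1, and its total is v₁ v₂.
-- Lower bound: for feasible w and minimal F₁, the column masses
-- b ↦ Σ_{a ∈ F₁} w (a , b) are feasible for 𝒮₂ by (R1), so the row sums
-- a ↦ Σ_b w (a , b) put mass ≥ v₂ on every minimal F₁; rescaling them by 1/v₂
-- gives a feasible point of 𝒮₁, whence v₁ v₂ ≤ Σ w.

open import Defs
open import Data.Nat using (ℕ; _*_)
open import Data.Rational using (ℚ) renaming (_*_ to _*ℚ_)

import Data.Nat as Nat
open import Data.Nat.Induction using (<-wellFounded)
open import Induction.WellFounded using (Acc; acc)
open import Data.Fin using (Fin; zero; suc; remQuot; combine; _↑ˡ_; _↑ʳ_)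
open import Data.Fin.Properties using (remQuot-combine)
open import Data.Fin.Subset using (Subset; _∈_; _⊆_; Nonempty; ∣_∣)
open import Data.Fin.Subset.Properties using (_∈?_; p⊂q⇒∣p∣<∣q∣)
open import Data.Bool using (true; false; if_then_else_; _∧_)
open import Data.Vec using (lookup; tabulate)
open import Data.Vec.Properties using ([]=⇒lookup; lookup⇒[]=; lookup∘tabulate)
open import Data.Product using (_×_; _,_; Σ; proj₁; proj₂)
open import Data.Empty using (⊥-elim)
open import Function using (id; _∘_; flip)
open import Relation.Nullary using (¬_; yes; no)
open import Relation.Nullary.Decidable using (decidable-stable)
open import Relation.Binary.Definitions using (tri<; tri≈; tri>)
open import Relation.Binary.PropositionalEquality
open import Data.Rational using (0ℚ; 1ℚ; _+_; _≤_; 1/_; NonZero; nonNegative; positive; >-nonZero)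
open import Data.Rational.Properties
open import Algebra.Bundles using (CommutativeRing)
open import Algebra.Properties.Semiring.Sum (CommutativeRing.semiring +-*-commutativeRing)
  using (sum; sum-cong-≗; sum-replicate-zero; ∑-comm; *-distribˡ-sum; *-distribʳ-sum)

0≤* : ∀ {a b} → 0ℚ ≤ a → 0ℚ ≤ b → 0ℚ ≤ a *ℚ b
0≤* {a} {b} 0≤a 0≤b =
  nonNegative⁻¹ _ {{nonNeg*nonNeg⇒nonNeg a {{nonNegative 0≤a}} b {{nonNegative 0≤b}}}}

1≤* : ∀ {a b} → 1ℚ ≤ a → 1ℚ ≤ b → 1ℚ ≤ a *ℚ b
1≤* {a} {b} 1≤a 1≤b = begin
  1ℚ        ≤⟨ 1≤a ⟩
  a         ≡⟨ sym (*-identityʳ a) ⟩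
  a *ℚ 1ℚ   ≤⟨ *-monoˡ-≤-nonNeg a {{nonNegative (≤-trans (nonNegative⁻¹ 1ℚ) 1≤a)}} 1≤b ⟩
  a *ℚ b    ∎
  where open ≤-Reasoning

-- Finite sums.  `sumFin` agrees with the library's `sum` over the semiring ℚ,
-- which lets us reuse Fubini and distributivity from the library.

sumFin≡sum : ∀ n (f : Fin n → ℚ) → sumFin n f ≡ sum f
sumFin≡sum Nat.zero    f = refl
sumFin≡sum (Nat.suc n) f = cong (f zero +_) (sumFin≡sum n (f ∘ suc))

sumFin-cong : ∀ n {f g : Fin n → ℚ} → (∀ i → f i ≡ g i) → sumFin n f ≡ sumFin n g
sumFin-cong Nat.zero    f≗g = refl
sumFin-cong (Nat.suc n) f≗g = cong₂ _+_ (f≗g zero) (sumFin-cong n (f≗g ∘ suc))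

sumFin-mono : ∀ n {f g : Fin n → ℚ} → (∀ i → f i ≤ g i) → sumFin n f ≤ sumFin n g
sumFin-mono Nat.zero    f≤g = ≤-refl
sumFin-mono (Nat.suc n) f≤g = +-mono-≤ (f≤g zero) (sumFin-mono n (f≤g ∘ suc))

sumFin-nonneg : ∀ n {f : Fin n → ℚ} → (∀ i → 0ℚ ≤ f i) → 0ℚ ≤ sumFin n f
sumFin-nonneg Nat.zero    0≤f = ≤-refl
sumFin-nonneg (Nat.suc n) 0≤f = +-mono-≤ (0≤f zero) (sumFin-nonneg n (0≤f ∘ suc))

sumFin-zero : ∀ n → sumFin n (λ _ → 0ℚ) ≡ 0ℚ
sumFin-zero n = trans (sumFin≡sum n _) (sum-replicate-zero n)

sumFin-*ˡ : ∀ n c (f : Fin n → ℚ) → sumFin n (λ i → c *ℚ f i) ≡ c *ℚ sumFin n f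
sumFin-*ˡ n c f = begin
  sumFin n (λ i → c *ℚ f i) ≡⟨ sumFin≡sum n _ ⟩
  sum (λ i → c *ℚ f i)      ≡⟨ *-distribˡ-sum c f ⟨
  c *ℚ sum f                ≡⟨ cong (c *ℚ_) (sumFin≡sum n f) ⟨
  c *ℚ sumFin n f           ∎
  where open ≡-Reasoning

sumFin-*ʳ : ∀ n c (f : Fin n → ℚ) → sumFin n (λ i → f i *ℚ c) ≡ sumFin n f *ℚ c
sumFin-*ʳ n c f = begin
  sumFin n (λ i → f i *ℚ c) ≡⟨ sumFin≡sum n _ ⟩
  sum (λ i → f i *ℚ c)      ≡⟨ *-distribʳ-sum c f ⟨
  sum f *ℚ c                ≡⟨ cong (_*ℚ c) (sumFin≡sum n f) ⟨
  sumFin n f *ℚ c           ∎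
  where open ≡-Reasoning

sumFin-comm : ∀ m n (f : Fin m → Fin n → ℚ) →
  sumFin m (λ a → sumFin n (f a)) ≡ sumFin n (λ b → sumFin m (λ a → f a b))
sumFin-comm m n f = begin
  sumFin m (λ a → sumFin n (f a))        ≡⟨ double m n f ⟩
  sum (λ a → sum (f a))                  ≡⟨ ∑-comm f ⟩
  sum (λ b → sum (λ a → f a b))          ≡⟨ double n m (flip f) ⟨
  sumFin n (λ b → sumFin m (λ a → f a b)) ∎
  where
  open ≡-Reasoning
  double : ∀ m n (g : Fin m → Fin n → ℚ) →
    sumFin m (λ a → sumFin n (g a)) ≡ sum (λ a → sum (g a))
  double m n g = trans (sumFin≡sum m _) (sum-cong-≗ (λ a → sumFin≡sum n (g a)))

sumFin-split : ∀ m n (f : Fin (m Nat.+ n) → ℚ) →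
  sumFin (m Nat.+ n) f ≡ sumFin m (λ i → f (i ↑ˡ n)) + sumFin n (λ j → f (m ↑ʳ j))
sumFin-split Nat.zero    n f = sym (+-identityˡ _)
sumFin-split (Nat.suc m) n f =
  trans (cong (f zero +_) (sumFin-split m n (f ∘ suc))) (sym (+-assoc (f zero) _ _))

sumFin-combine : ∀ m n (f : Fin (m * n) → ℚ) →
  sumFin (m * n) f ≡ sumFin m (λ a → sumFin n (λ b → f (combine a b)))
sumFin-combine Nat.zero    n f = refl
sumFin-combine (Nat.suc m) n f = trans (sumFin-split n (m * n) f)
  (cong (sumFin n (λ b → f (b ↑ˡ (m * n))) +_) (sumFin-combine m n (λ k → f (n ↑ʳ k))))

restrict : ∀ {n} → Subset n → (Fin n → ℚ) → Fin n → ℚ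
restrict F f i = if lookup F i then f i else 0ℚ

restrict-nonneg : ∀ {n} (F : Subset n) {f : Fin n → ℚ} → (∀ i → 0ℚ ≤ f i) →
  ∀ i → 0ℚ ≤ restrict F f i
restrict-nonneg F 0≤f i with lookup F i
... | true  = 0≤f i
... | false = ≤-refl

sumOn-mono-⊆ : ∀ {n} {F G : Subset n} (f : Fin n → ℚ) → (∀ i → 0ℚ ≤ f i) →
  F ⊆ G → sumOn F f ≤ sumOn G f
sumOn-mono-⊆ {n} {F} {G} f 0≤f F⊆G = sumFin-mono n restrict-mono
  where
  restrict-mono : ∀ i → restrict F f i ≤ restrict G f i
  restrict-mono i with lookup F i in i∈F | lookup G i in i∈G
  ... | true  | true  = ≤-refl
  ... | false | true  = 0≤f i
  ... | false | false = ≤-refl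
  -- i ∈ F forces i ∈ G, so lookup G i cannot be false
  ... | true  | false with () ← trans (sym ([]=⇒lookup (F⊆G (lookup⇒[]= i F i∈F)))) i∈G

sumOn-*ʳ : ∀ {n} (F : Subset n) (f : Fin n → ℚ) c →
  sumOn F (λ i → f i *ℚ c) ≡ sumOn F f *ℚ c
sumOn-*ʳ {n} F f c = trans (sumFin-cong n restrict-*ʳ) (sumFin-*ʳ n c (restrict F f))
  where
  restrict-*ʳ : ∀ i → restrict F (λ i → f i *ℚ c) i ≡ restrict F f i *ℚ c
  restrict-*ʳ i with lookup F i
  ... | true  = refl
  ... | false = sym (*-zeroˡ c)

restrict-sumFin : ∀ {m} n (F : Subset m) (g : Fin m → Fin n → ℚ) a →
  restrict F (λ a → sumFin n (g a)) a ≡ sumFin n (λ b → restrict F (λ a → g a b) a)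
restrict-sumFin n F g a with lookup F a
... | true  = refl
... | false = sym (sumFin-zero n)

sumOn-comm : ∀ {m} n (F : Subset m) (g : Fin m → Fin n → ℚ) →
  sumOn F (λ a → sumFin n (g a)) ≡ sumFin n (λ b → sumOn F (λ a → g a b))
sumOn-comm {m} n F g =
  trans (sumFin-cong m (restrict-sumFin n F g)) (sumFin-comm m n _)

-- Rectangles in X₁ × X₂ ≅ Fin (n₁ * n₂), and the tensor product of weights.
module _ {n₁ n₂ : ℕ} where

  rect : Subset n₁ → Subset n₂ → Subset (n₁ * n₂)
  rect F₁ F₂ = tabulate λ k →
    lookup F₁ (proj₁ (remQuot {n₁} n₂ k)) ∧ lookup F₂ (proj₂ (remQuot {n₁} n₂ k))

  _⊗_ : (Fin n₁ → ℚ) → (Fin n₂ → ℚ) → Fin (n₁ * n₂) → ℚ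
  (x ⊗ y) k = x (proj₁ (remQuot {n₁} n₂ k)) *ℚ y (proj₂ (remQuot {n₁} n₂ k))

  lookup-rect : ∀ F₁ F₂ k → lookup (rect F₁ F₂) k ≡
    lookup F₁ (proj₁ (remQuot {n₁} n₂ k)) ∧ lookup F₂ (proj₂ (remQuot {n₁} n₂ k))
  lookup-rect F₁ F₂ = lookup∘tabulate _

  lookup-rect-combine : ∀ F₁ F₂ a b →
    lookup (rect F₁ F₂) (combine a b) ≡ lookup F₁ a ∧ lookup F₂ b
  lookup-rect-combine F₁ F₂ a b = trans (lookup-rect F₁ F₂ (combine a b))
    (cong (λ p → lookup F₁ (proj₁ p) ∧ lookup F₂ (proj₂ p)) (remQuot-combine a b))

  ⊗-combine : ∀ x y a b → (x ⊗ y) (combine a b) ≡ x a *ℚ y b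
  ⊗-combine x y a b = cong (λ p → x (proj₁ p) *ℚ y (proj₂ p)) (remQuot-combine a b)

  ∈rect⇒inRect : ∀ F₁ F₂ {k} → k ∈ rect F₁ F₂ → inRect F₁ F₂ k
  ∈rect⇒inRect F₁ F₂ {k} k∈R =
    both (trans (sym (lookup-rect F₁ F₂ k)) ([]=⇒lookup k∈R))
    where
    both : ∀ {p q} → lookup F₁ p ∧ lookup F₂ q ≡ true → p ∈ F₁ × q ∈ F₂
    both {p} {q} e with lookup F₁ p in p∈F₁ | lookup F₂ q in q∈F₂ | e
    ... | true | true | refl = lookup⇒[]= p F₁ p∈F₁ , lookup⇒[]= q F₂ q∈F₂

  inRect⇒∈rect : ∀ {F₁ F₂ k} → inRect F₁ F₂ k → k ∈ rect F₁ F₂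
  inRect⇒∈rect {F₁} {F₂} {k} (p∈F₁ , q∈F₂) = lookup⇒[]= k (rect F₁ F₂)
    (trans (lookup-rect F₁ F₂ k) (cong₂ _∧_ ([]=⇒lookup p∈F₁) ([]=⇒lookup q∈F₂)))

  combine-inRect : ∀ {A B a b} → a ∈ A → b ∈ B → inRect A B (combine a b)
  combine-inRect {A} {B} {a} {b} a∈A b∈B =
    subst (λ p → proj₁ p ∈ A × proj₂ p ∈ B) (sym (remQuot-combine {n₁} {n₂} a b)) (a∈A , b∈B)

  inRect-combine⁻ : ∀ {A B a b} → inRect A B (combine a b) → a ∈ A × b ∈ B
  inRect-combine⁻ {A} {B} {a} {b} =
    subst (λ p → proj₁ p ∈ A × proj₂ p ∈ B) (remQuot-combine {n₁} {n₂} a b)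

  inRect-⊆ˡ : ∀ {A B C D b} → (∀ k → inRect A B k → inRect C D k) → b ∈ B → A ⊆ C
  inRect-⊆ˡ A×B⊆C×D b∈B a∈A = proj₁ (inRect-combine⁻ (A×B⊆C×D _ (combine-inRect a∈A b∈B)))

  inRect-⊆ʳ : ∀ {A B C D a} → (∀ k → inRect A B k → inRect C D k) → a ∈ A → B ⊆ D
  inRect-⊆ʳ A×B⊆C×D a∈A b∈B = proj₂ (inRect-combine⁻ (A×B⊆C×D _ (combine-inRect a∈A b∈B)))

  sumFin-⊗ : ∀ x y → sumFin (n₁ * n₂) (x ⊗ y) ≡ sumFin n₁ x *ℚ sumFin n₂ y
  sumFin-⊗ x y = begin
    sumFin (n₁ * n₂) (x ⊗ y)                          ≡⟨ sumFin-combine n₁ n₂ (x ⊗ y) ⟩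
    sumFin n₁ (λ a → sumFin n₂ (λ b → (x ⊗ y) (combine a b)))
      ≡⟨ sumFin-cong n₁ (λ a → sumFin-cong n₂ (⊗-combine x y a)) ⟩
    sumFin n₁ (λ a → sumFin n₂ (λ b → x a *ℚ y b))    ≡⟨ sumFin-cong n₁ (λ a → sumFin-*ˡ n₂ (x a) y) ⟩
    sumFin n₁ (λ a → x a *ℚ sumFin n₂ y)              ≡⟨ sumFin-*ʳ n₁ (sumFin n₂ y) x ⟩
    sumFin n₁ x *ℚ sumFin n₂ y                        ∎
    where open ≡-Reasoning

  sumOn-rect-⊗ : ∀ F₁ F₂ x y → sumOn (rect F₁ F₂) (x ⊗ y) ≡ sumOn F₁ x *ℚ sumOn F₂ y
  sumOn-rect-⊗ F₁ F₂ x y =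
    trans (sumFin-cong (n₁ * n₂) restrict-⊗) (sumFin-⊗ (restrict F₁ x) (restrict F₂ y))
    where
    if-∧-* : ∀ p q X Y → (if p ∧ q then X *ℚ Y else 0ℚ) ≡
      (if p then X else 0ℚ) *ℚ (if q then Y else 0ℚ)
    if-∧-* true  true  X Y = refl
    if-∧-* true  false X Y = sym (*-zeroʳ X)
    if-∧-* false q     X Y = sym (*-zeroˡ (if q then Y else 0ℚ))
    restrict-⊗ : ∀ k → restrict (rect F₁ F₂) (x ⊗ y) k ≡ (restrict F₁ x ⊗ restrict F₂ y) k
    restrict-⊗ k = trans (cong (λ p → if p then (x ⊗ y) k else 0ℚ) (lookup-rect F₁ F₂ k))
      (if-∧-* (lookup F₁ (proj₁ (remQuot {n₁} n₂ k))) (lookup F₂ (proj₂ (remQuot {n₁} n₂ k))) _ _)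

  sumOn-rect : ∀ F₁ F₂ (w : Fin (n₁ * n₂) → ℚ) →
    sumOn (rect F₁ F₂) w ≡ sumOn F₂ (λ b → sumOn F₁ (λ a → w (combine a b)))
  sumOn-rect F₁ F₂ w = begin
    sumOn (rect F₁ F₂) w                             ≡⟨ sumFin-combine n₁ n₂ _ ⟩
    sumFin n₁ (λ a → sumFin n₂ (λ b → restrict (rect F₁ F₂) w (combine a b)))
      ≡⟨ sumFin-cong n₁ (λ a → sumFin-cong n₂ (restrict-rect a)) ⟩
    sumFin n₁ (λ a → sumFin n₂ (λ b → restrict F₂ (column a) b)) ≡⟨ sumFin-comm n₁ n₂ _ ⟩
    sumFin n₂ (λ b → sumFin n₁ (λ a → restrict F₂ (column a) b))
      ≡⟨ sumFin-cong n₂ (λ b → sym (restrict-sumFin n₁ F₂ (flip column) b)) ⟩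
    sumOn F₂ (λ b → sumOn F₁ (λ a → w (combine a b))) ∎
    where
    open ≡-Reasoning
    column : Fin n₁ → Fin n₂ → ℚ
    column a b = restrict F₁ (λ a → w (combine a b)) a
    if-∧ : ∀ p q t → (if p ∧ q then t else 0ℚ) ≡ (if q then (if p then t else 0ℚ) else 0ℚ)
    if-∧ true  q     t = refl
    if-∧ false true  t = refl
    if-∧ false false t = refl
    restrict-rect : ∀ a b → restrict (rect F₁ F₂) w (combine a b) ≡ restrict F₂ (column a) b
    restrict-rect a b =
      trans (cong (λ p → if p then w (combine a b) else 0ℚ) (lookup-rect-combine F₁ F₂ a b))
        (if-∧ (lookup F₁ a) (lookup F₂ b) (w (combine a b)))

-- Openness is
-- not decidable here, so the choice is classical and the result double-negated;
-- the proof is well-founded induction on the size of the set.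
minimalOpenWithin : ∀ {n} (𝒮 : Spanoid n) {A} → IsOpen 𝒮 A → Nonempty A →
  ¬ ¬ (Σ (Subset n) λ F → IsMinOpen 𝒮 F × F ⊆ A)
minimalOpenWithin 𝒮 {A} = go A (<-wellFounded ∣ A ∣)
  where
  go : ∀ A → Acc Nat._<_ ∣ A ∣ → IsOpen 𝒮 A → Nonempty A →
    ¬ ¬ (Σ _ λ F → IsMinOpen 𝒮 F × F ⊆ A)
  go A (acc smaller) openA nonemptyA noMinimal = noMinimal (A , (openA , nonemptyA , minimal) , id)
    where
    minimal : ∀ G → IsOpen 𝒮 G → Nonempty G → G ⊆ A → A ⊆ G
    minimal G openG nonemptyG G⊆A {i} i∈A with i ∈? G
    ... | yes i∈G = i∈G
    ... | no  i∉G = ⊥-elim (go G (smaller (p⊂q⇒∣p∣<∣q∣ (G⊆A , i , i∈A , i∉G))) openG nonemptyG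
                      λ { (F , minF , F⊆G) → noMinimal (F , minF , G⊆A ∘ F⊆G) })

LPcover-nonneg : ∀ {n} {𝒮 : Spanoid n} {v} → LPcoverIs 𝒮 v → 0ℚ ≤ v
LPcover-nonneg {n} ((x , (0≤x , _) , Σx≡v) , _) = subst (0ℚ ≤_) Σx≡v (sumFin-nonneg n 0≤x)

-- Rescaled feasibility: a nonnegative x giving mass ≥ c ≥ 0
-- to every minimal open set has total mass ≥ v · c (x / c is feasible).
scaledLowerBound : ∀ {n} {𝒮 : Spanoid n} {v c} {x : Fin n → ℚ} →
  (∀ x → IsCoverFeasible 𝒮 x → v ≤ sumFin n x) → 0ℚ ≤ c →
  (∀ i → 0ℚ ≤ x i) → (∀ F → IsMinOpen 𝒮 F → c ≤ sumOn F x) → v *ℚ c ≤ sumFin n x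
scaledLowerBound {n} {𝒮} {v} {c} {x} lower 0≤c 0≤x massOn with <-cmp 0ℚ c
... | tri> _ _ c<0 = ⊥-elim (<-irrefl refl (<-≤-trans c<0 0≤c))
... | tri≈ _ refl _ = subst (_≤ sumFin n x) (sym (*-zeroʳ v)) (sumFin-nonneg n 0≤x)
... | tri< 0<c _ _ = begin
  v *ℚ c                            ≤⟨ *-monoʳ-≤-nonNeg c {{nonNegative 0≤c}} (lower x/c x/c-feasible) ⟩
  sumFin n x/c *ℚ c                 ≡⟨ cong (_*ℚ c) (sumFin-*ʳ n c⁻¹ x) ⟩
  (sumFin n x *ℚ c⁻¹) *ℚ c          ≡⟨ *-assoc (sumFin n x) c⁻¹ c ⟩
  sumFin n x *ℚ (c⁻¹ *ℚ c)          ≡⟨ cong (sumFin n x *ℚ_) (*-inverseˡ c) ⟩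
  sumFin n x *ℚ 1ℚ                  ≡⟨ *-identityʳ _ ⟩
  sumFin n x                        ∎
  where
  open ≤-Reasoning
  instance
    c≢0 : NonZero c
    c≢0 = >-nonZero 0<c
  c⁻¹ : ℚ
  c⁻¹ = 1/ c
  0≤c⁻¹ : 0ℚ ≤ c⁻¹
  0≤c⁻¹ = <⇒≤ (positive⁻¹ c⁻¹ {{1/pos⇒pos c {{positive 0<c}}}})
  x/c : Fin n → ℚ
  x/c i = x i *ℚ c⁻¹
  x/c-feasible : IsCoverFeasible 𝒮 x/c
  x/c-feasible = (λ i → 0≤* (0≤x i) 0≤c⁻¹) , λ F minF → begin
    1ℚ                  ≡⟨ *-inverseʳ c ⟨
    c *ℚ c⁻¹            ≤⟨ *-monoʳ-≤-nonNeg c⁻¹ {{nonNegative 0≤c⁻¹}} (massOn F minF) ⟩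
    sumOn F x *ℚ c⁻¹    ≡⟨ sumOn-*ʳ F x c⁻¹ ⟨
    sumOn F x/c         ∎

module _ {n₁ n₂ : ℕ} {𝒮₁ : Spanoid n₁} {𝒮₂ : Spanoid n₂} {𝒮 : Spanoid (n₁ * n₂)}
         (product : IsProduct 𝒮₁ 𝒮₂ 𝒮) where

  rectOpen : ∀ {A B} → IsOpen 𝒮₁ A → IsOpen 𝒮₂ B → IsOpen 𝒮 (rect A B)
  rectOpen {A} {B} openA openB = proj₂ (product (rect A B))
    λ k k∈R → A , B , openA , openB , ∈rect⇒inRect A B k∈R , λ k' → inRect⇒∈rect

  -- (R1) A rectangle of minimal open sets is minimal open: any nonempty open G
  -- inside it contains an open rectangle A × B, and A × B ⊆ F₁ × F₂ forces
  -- A = F₁ and B = F₂ by minimality.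
  rectMinOpen : ∀ {F₁ F₂} → IsMinOpen 𝒮₁ F₁ → IsMinOpen 𝒮₂ F₂ → IsMinOpen 𝒮 (rect F₁ F₂)
  rectMinOpen {F₁} {F₂} (open₁ , (a , a∈F₁) , min₁) (open₂ , (b , b∈F₂) , min₂) =
    rectOpen open₁ open₂ ,
    (combine a b , inRect⇒∈rect (combine-inRect a∈F₁ b∈F₂)) ,
    minimal
    where
    minimal : ∀ G → IsOpen 𝒮 G → Nonempty G → G ⊆ rect F₁ F₂ → rect F₁ F₂ ⊆ G
    minimal G openG (k , k∈G) G⊆R {k'} k'∈R
      with proj₁ (product G) openG k k∈G
    ... | A , B , openA , openB , (a∈A , b∈B) , A×B⊆G =
      A×B⊆G k' (F₁⊆A (proj₁ (∈rect⇒inRect F₁ F₂ k'∈R)) , F₂⊆B (proj₂ (∈rect⇒inRect F₁ F₂ k'∈R)))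
      where
      A×B⊆F₁×F₂ : ∀ k → inRect A B k → inRect F₁ F₂ k
      A×B⊆F₁×F₂ k = ∈rect⇒inRect F₁ F₂ ∘ G⊆R ∘ A×B⊆G k
      F₁⊆A : F₁ ⊆ A
      F₁⊆A = min₁ A openA (_ , a∈A) (inRect-⊆ˡ A×B⊆F₁×F₂ b∈B)
      F₂⊆B : F₂ ⊆ B
      F₂⊆B = min₂ B openB (_ , b∈B) (inRect-⊆ʳ A×B⊆F₁×F₂ a∈A)

  minRectWithin : ∀ {U} → IsOpen 𝒮 U → Nonempty U →
    ¬ ¬ (Σ (Subset n₁) λ F₁ → Σ (Subset n₂) λ F₂ →
          IsMinOpen 𝒮₁ F₁ × IsMinOpen 𝒮₂ F₂ × rect F₁ F₂ ⊆ U)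
  minRectWithin {U} openU (k , k∈U) noRect
    with proj₁ (product U) openU k k∈U
  ... | A , B , openA , openB , (a∈A , b∈B) , A×B⊆U =
    minimalOpenWithin 𝒮₁ openA (_ , a∈A) λ { (F₁ , min₁ , F₁⊆A) →
    minimalOpenWithin 𝒮₂ openB (_ , b∈B) λ { (F₂ , min₂ , F₂⊆B) →
    noRect (F₁ , F₂ , min₁ , min₂ , λ k'∈R →
      let (p∈F₁ , q∈F₂) = ∈rect⇒inRect F₁ F₂ k'∈R in A×B⊆U _ (F₁⊆A p∈F₁ , F₂⊆B q∈F₂)) } }

  -- Upper bound: the tensor of feasible points is feasible, by (R2).
  tensorFeasible : ∀ {x y} → IsCoverFeasible 𝒮₁ x → IsCoverFeasible 𝒮₂ y →
    IsCoverFeasible 𝒮 (x ⊗ y)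
  tensorFeasible {x} {y} (0≤x , covers₁) (0≤y , covers₂) = 0≤x⊗y , covers
    where
    0≤x⊗y : ∀ k → 0ℚ ≤ (x ⊗ y) k
    0≤x⊗y k = 0≤* (0≤x _) (0≤y _)
    covers : ∀ F → IsMinOpen 𝒮 F → 1ℚ ≤ sumOn F (x ⊗ y)
    covers F (openF , nonemptyF , _) = decidable-stable (1ℚ ≤? sumOn F (x ⊗ y))
      λ notCovered → minRectWithin openF nonemptyF
        λ { (F₁ , F₂ , min₁ , min₂ , R⊆F) → notCovered (begin
          1ℚ                              ≤⟨ 1≤* (covers₁ F₁ min₁) (covers₂ F₂ min₂) ⟩
          sumOn F₁ x *ℚ sumOn F₂ y        ≡⟨ sumOn-rect-⊗ F₁ F₂ x y ⟨
          sumOn (rect F₁ F₂) (x ⊗ y)      ≤⟨ sumOn-mono-⊆ (x ⊗ y) 0≤x⊗y R⊆F ⟩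
          sumOn F (x ⊗ y)                 ∎) }
      where open ≤-Reasoning

  -- Lower bound: the row sums of a feasible w put mass ≥ v₂ on every minimal
  -- open F₁ of 𝒮₁, because the column masses over F₁ are feasible for 𝒮₂ (R1).
  productLowerBound : ∀ {v₁ v₂} → LPcoverIs 𝒮₁ v₁ → LPcoverIs 𝒮₂ v₂ →
    ∀ w → IsCoverFeasible 𝒮 w → v₁ *ℚ v₂ ≤ sumFin (n₁ * n₂) w
  productLowerBound {v₁} {v₂} (_ , lower₁) opt₂@(_ , lower₂) w (0≤w , coversW) =
    subst (v₁ *ℚ v₂ ≤_) (sym (sumFin-combine n₁ n₂ w))
      (scaledLowerBound lower₁ (LPcover-nonneg opt₂)
        (λ a → sumFin-nonneg n₂ (λ b → 0≤w (combine a b))) rowMass)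
    where
    rowSum : Fin n₁ → ℚ
    rowSum a = sumFin n₂ (λ b → w (combine a b))
    columnMass : Subset n₁ → Fin n₂ → ℚ
    columnMass F₁ b = sumOn F₁ (λ a → w (combine a b))
    columnMass-feasible : ∀ F₁ → IsMinOpen 𝒮₁ F₁ → IsCoverFeasible 𝒮₂ (columnMass F₁)
    columnMass-feasible F₁ min₁ =
      (λ b → sumFin-nonneg n₁ (restrict-nonneg F₁ (λ a → 0≤w (combine a b)))) ,
      λ F₂ min₂ → subst (1ℚ ≤_) (sumOn-rect F₁ F₂ w) (coversW (rect F₁ F₂) (rectMinOpen min₁ min₂))
    rowMass : ∀ F₁ → IsMinOpen 𝒮₁ F₁ → v₂ ≤ sumOn F₁ rowSum
    rowMass F₁ min₁ = subst (v₂ ≤_) (sym (sumOn-comm n₂ F₁ (λ a b → w (combine a b))))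
      (lower₂ (columnMass F₁) (columnMass-feasible F₁ min₁))

mainTheorem17 : (n₁ n₂ : ℕ) (𝒮₁ : Spanoid n₁) (𝒮₂ : Spanoid n₂) (𝒮 : Spanoid (n₁ * n₂)) →
    IsProduct 𝒮₁ 𝒮₂ 𝒮 →
    (v₁ v₂ : ℚ) → LPcoverIs 𝒮₁ v₁ → LPcoverIs 𝒮₂ v₂ → LPcoverIs 𝒮 (v₁ *ℚ v₂)
mainTheorem17 n₁ n₂ 𝒮₁ 𝒮₂ 𝒮 product v₁ v₂ opt₁@((x , feasible₁ , Σx≡v₁) , _)
                                         opt₂@((y , feasible₂ , Σy≡v₂) , _) =
  (x ⊗ y , tensorFeasible product feasible₁ feasible₂ ,
           trans (sumFin-⊗ x y) (cong₂ _*ℚ_ Σx≡v₁ Σy≡v₂)) ,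
  productLowerBound product opt₁ opt₂
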